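{- Let $(\Sigma,\Gamma,\mathcal U)$ be a (pure) many-sorted finite model finding problem and let $f:A\to B$ be a function symbol of $\Sigma$ with $A$ and $B$ distinct sorts. Enumerate $\mathcal U(A)$ as $a_1,\dots,a_m$ and $\mathcal U(B)$ as $b_1,\dots,b_n$ (each without repetition). Let $I$ be any interpretation of $(\Sigma,\Gamma,\mathcal U)$. Then there exists an interpretation $I'$ isomorphic to $I$ satisfying the strong ordered range constraints $\bigvee_{j=1}^{i} f(a_i)=b_j$ for each $i=1,\dots,\min\{m,n\}$, i.e. $I'(f)(a_i)\in\{b_1,\dots,b_i\}$ for these $i$.
   Context: A signature $\Sigma$ consists of a finite set of sorts, a finite set of function symbols $g:A_1\times\dots\times A_n\to B$ (constants when $n=0$), and a finite set of predicate symbols $R:A_1\times\dots\times A_n\to\mathrm{Bool}$. A domain assignment $\mathcal U$ maps each sort to a nonempty finite set. A (pure) MSFMF problem is $(\Sigma,\Gamma,\mathcal U)$ with $\Gamma$ a finite set of many-sorted first-order formulas (with equality) over $\Sigma$ not mentioning domain elements. An interpretation $I$ assigns each function symbol $g:A_1\times\dots\times A_n\to B$ a function $\mathcal U(A_1)\times\dots\times\mathcal U(A_n)\to\mathcal U(B)$ and each predicate symbol a relation on the corresponding product of domains. A domain permutation $\sigma$ is a family of permutations $\sigma_\theta$ of $\mathcal U(\theta)$, one per sort; it acts by $(\sigma\bullet I)(g)(\sigma_{A_1}(a_1),\dots,\sigma_{A_n}(a_n))=\sigma_B(I(g)(a_1,\dots,a_n))$ and $(a_1,\dots,a_n)\in I(R)\iff(\sigma_{A_1}(a_1),\dots,\sigma_{A_n}(a_n))\in(\sigma\bullet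 I)(R)$. Interpretations $I,I'$ are isomorphic if $I'=\sigma\bullet I$ for some domain permutation $\sigma$. -}

module Defs where

open import Data.Nat using (ℕ; NonZero)
open import Data.Fin using (Fin)
open import Data.List using (List; []; _∷_)
open import Data.Bool using (Bool)
open import Data.Unit using (⊤; tt)
open import Data.Product using (_×_; _,_; Σ-syntax)
open import Function.Bundles using (_↔_; Inverse)
open import Relation.Binary.PropositionalEquality using (_≡_)

record Signature : Set where
  field
    nSorts : ℕ
    nFun   : ℕ
    nPred  : ℕ
    funArgs : Fin nFun → List (Fin nSorts)
    funRes  : Fin nFun → Fin nSorts
    predArgs : Fin nPred → List (Fin nSorts)
open Signature public

record DomainAssignment (Σ : Signature) : Set where
  field
    size     : Fin (nSorts Σ) → ℕ
    nonEmpty : (θ : Fin (nSorts Σ)) → NonZero (size θ)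
open DomainAssignment public

module _ {Σ : Signature} (𝒰 : DomainAssignment Σ) where

  Dom : Fin (nSorts Σ) → Set
  Dom θ = Fin (size 𝒰 θ)

  Tuple : List (Fin (nSorts Σ)) → Set
  Tuple []       = ⊤
  Tuple (θ ∷ θs) = Dom θ × Tuple θs

  -- An interpretation: functions on the domains, relations as Bool-valued
  -- characteristic functions (the domains are finite).
  record Interpretation : Set where
    field
      funI  : (g : Fin (nFun Σ)) → Tuple (funArgs Σ g) → Dom (funRes Σ g)
      predI : (R : Fin (nPred Σ)) → Tuple (predArgs Σ R) → Bool
  open Interpretation public

  DomainPermutation : Set
  DomainPermutation = (θ : Fin (nSorts Σ)) → Dom θ ↔ Dom θ

  applyPerm : DomainPermutation → (θ : Fin (nSorts Σ)) → Dom θ → Dom θ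
  applyPerm σ θ = Inverse.to (σ θ)

  permTuple : DomainPermutation → (θs : List (Fin (nSorts Σ))) → Tuple θs → Tuple θs
  permTuple σ []       tt       = tt
  permTuple σ (θ ∷ θs) (x , xs) = applyPerm σ θ x , permTuple σ θs xs

  -- I' = σ • I, spelled out exactly as the defining equations of the action
  -- (pointwise, since interpretations are functions).
  IsAction : DomainPermutation → Interpretation → Interpretation → Set
  IsAction σ I I' =
    ((g : Fin (nFun Σ)) (as : Tuple (funArgs Σ g)) →
       funI I' g (permTuple σ (funArgs Σ g) as) ≡ applyPerm σ (funRes Σ g) (funI I g as))
    × ((R : Fin (nPred Σ)) (as : Tuple (predArgs Σ R)) →
       predI I R as ≡ predI I' R (permTuple σ (predArgs Σ R) as))

  Isomorphic : Interpretation → Interpretation → Set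
  Isomorphic I I' = Σ[ σ ∈ DomainPermutation ] IsAction σ I I'

-- Only sort B is relabelled. Scanning a₁, a₂, … keep a permutation π of U(B)
-- with π(f(aₖ)) ∈ {b₁, …, bₖ} for all earlier k. If π(f(aᵢ)) lies outside
-- {b₁, …, bᵢ}, then neither it nor bᵢ is π(f(aₖ)) for an earlier k, so
-- composing π with their transposition keeps the earlier constraints and
-- establishes the i-th. Since A ≠ B, acting by π on B alone leaves the
-- argument of f untouched.
module Submission where

open import Defs
open import Data.Nat using (ℕ; zero; suc; _≤_; _<_; _≤?_; _<?_)
open import Data.Nat.Properties using (m<1+n⇒m<n∨m≡n; ≤-refl; ≤-<-trans; <⇒≤; <⇒≢)
open import Data.Fin using (Fin; toℕ; fromℕ<; _≟_)
open import Data.Fin.Properties using (toℕ-injective; toℕ<n; toℕ-fromℕ<)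
open import Data.Fin.Permutation using (Permutation; _⟨$⟩ʳ_; _∘ₚ_; transpose; id)
import Data.Fin.Permutation.Components as PC
open import Data.List using (List; []; _∷_)
open import Data.Unit using (tt)
open import Data.Empty using (⊥-elim)
open import Data.Sum using (inj₁; inj₂)
open import Data.Product using (_×_; _,_; Σ-syntax; proj₁; proj₂)
open import Function.Base using (_∘′_)
open import Function.Bundles using (_↔_; Inverse)
open import Function.Properties.Inverse using (↔-trans; ↔-sym; ↔-refl)
open import Axiom.UniquenessOfIdentityProofs using (module Decidable⇒UIP)
open import Relation.Binary.PropositionalEquality
  using (_≡_; _≢_; refl; sym; trans; cong; cong₂; subst; module ≡-Reasoning)
open import Relation.Nullary using (¬_; yes; no)
open import Relation.Nullary.Decidable using (dec-true; dec-false; dec-yes-irr)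

transpose-matchˡ : ∀ {n} (i j : Fin n) → PC.transpose i j i ≡ j
transpose-matchˡ i j rewrite dec-true (i ≟ i) refl = refl

transpose-unmatched : ∀ {n} {i j k : Fin n} → k ≢ i → k ≢ j → PC.transpose i j k ≡ k
transpose-unmatched {i = i} {j} {k} k≢i k≢j
  rewrite dec-false (k ≟ i) k≢i | dec-false (k ≟ j) k≢j = refl

module _ {m n : ℕ} (h : Fin m → Fin n) where

  RangeOrderedAt : Permutation n n → Fin m → Set
  RangeOrderedAt π i = toℕ i < n → toℕ (π ⟨$⟩ʳ h i) ≤ toℕ i

  RangeOrderedBelow : ℕ → Permutation n n → Set
  RangeOrderedBelow t π = ∀ i → toℕ i < t → RangeOrderedAt π i

  rangeOrderedBelow-suc : ∀ {t π} → RangeOrderedBelow t π →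
    (∀ i → toℕ i ≡ t → RangeOrderedAt π i) → RangeOrderedBelow (suc t) π
  rangeOrderedBelow-suc below at i i<1+t with m<1+n⇒m<n∨m≡n i<1+t
  ... | inj₁ i<t = below i i<t
  ... | inj₂ i≡t = at i i≡t

  rangeOrderedBelow-place : ∀ {t π} (k : Fin m) → toℕ k ≡ t → t < n →
    RangeOrderedBelow t π → Σ[ π′ ∈ Permutation n n ] RangeOrderedBelow (suc t) π′
  rangeOrderedBelow-place {t} {π} k refl k<n below with toℕ (π ⟨$⟩ʳ h k) ≤? toℕ k
  ... | yes placed = π , rangeOrderedBelow-suc {toℕ k} {π} below at
    where
    at : ∀ i → toℕ i ≡ toℕ k → RangeOrderedAt π i
    at i i≡k _ rewrite toℕ-injective i≡k = placed
  ... | no unplaced =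
    π ∘ₚ transpose p j , rangeOrderedBelow-suc {toℕ k} {π ∘ₚ transpose p j} unmoved at
    where
    p j : Fin n
    p = π ⟨$⟩ʳ h k
    j = fromℕ< k<n

    unmoved : RangeOrderedBelow (toℕ k) (π ∘ₚ transpose p j)
    unmoved i i<k i<n =
      subst (λ r → toℕ r ≤ toℕ i) (sym (transpose-unmatched q≢p q≢j)) q≤i
      where
      q : Fin n
      q = π ⟨$⟩ʳ h i
      q≤i : toℕ q ≤ toℕ i
      q≤i = below i i<k i<n
      q<k : toℕ q < toℕ k
      q<k = ≤-<-trans q≤i i<k
      q≢p : q ≢ p
      q≢p q≡p = unplaced (<⇒≤ (subst (λ z → toℕ z < toℕ k) q≡p q<k))
      q≢j : q ≢ j
      q≢j q≡j = <⇒≢ q<k (trans (cong toℕ q≡j) (toℕ-fromℕ< k<n))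

    at : ∀ i → toℕ i ≡ toℕ k → RangeOrderedAt (π ∘ₚ transpose p j) i
    at i i≡k _ rewrite toℕ-injective i≡k | transpose-matchˡ p j | toℕ-fromℕ< k<n =
      ≤-refl

  rangeOrderedBelow : ∀ t → Σ[ π ∈ Permutation n n ] RangeOrderedBelow t π
  rangeOrderedBelow zero = id , λ _ ()
  rangeOrderedBelow (suc t) with rangeOrderedBelow t | t <? m | t <? n
  ... | π , below | yes t<m | yes t<n =
    rangeOrderedBelow-place {t} {π} (fromℕ< t<m) (toℕ-fromℕ< t<m) t<n below
  ... | π , below | no t≮m | _ =
    π , rangeOrderedBelow-suc {t} {π} below
          λ i i≡t _ → ⊥-elim (t≮m (subst (_< m) i≡t (toℕ<n i)))
  ... | π , below | _ | no t≮n =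
    π , rangeOrderedBelow-suc {t} {π} below
          λ i i≡t i<n → ⊥-elim (t≮n (subst (_< n) i≡t i<n))

  rangeOrdering : Σ[ π ∈ Permutation n n ] (∀ i → RangeOrderedAt π i)
  rangeOrdering with rangeOrderedBelow m
  ... | π , below = π , λ i → below i (toℕ<n i)

module _ {Σ : Signature} {𝒰 : DomainAssignment Σ} where

  inverse : DomainPermutation 𝒰 → DomainPermutation 𝒰
  inverse σ θ = ↔-sym (σ θ)

  permTuple-inverse : (σ : DomainPermutation 𝒰)
    (θs : List (Fin (nSorts Σ))) (as : Tuple 𝒰 θs) →
    permTuple 𝒰 (inverse σ) θs (permTuple 𝒰 σ θs as) ≡ as
  permTuple-inverse σ []       tt       = refl
  permTuple-inverse σ (θ ∷ θs) (a , as) =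
    cong₂ _,_ (Inverse.strictlyInverseʳ (σ θ) a) (permTuple-inverse σ θs as)

  infixr 5 _•_
  _•_ : DomainPermutation 𝒰 → Interpretation 𝒰 → Interpretation 𝒰
  σ • I = record
    { funI  = λ g as →
        applyPerm 𝒰 σ (funRes Σ g) (funI I g (permTuple 𝒰 (inverse σ) (funArgs Σ g) as))
    ; predI = λ R as → predI I R (permTuple 𝒰 (inverse σ) (predArgs Σ R) as)
    }

  •-isomorphic : (σ : DomainPermutation 𝒰) (I : Interpretation 𝒰) → Isomorphic 𝒰 I (σ • I)
  •-isomorphic σ I = σ , funI-• , predI-•
    where
    funI-• : ∀ g as → funI (σ • I) g (permTuple 𝒰 σ (funArgs Σ g) as)
                      ≡ applyPerm 𝒰 σ (funRes Σ g) (funI I g as)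
    funI-• g as =
      cong (applyPerm 𝒰 σ (funRes Σ g) ∘′ funI I g) (permTuple-inverse σ (funArgs Σ g) as)

    predI-• : ∀ R as → predI I R as ≡ predI (σ • I) R (permTuple 𝒰 σ (predArgs Σ R) as)
    predI-• R as = sym (cong (predI I R) (permTuple-inverse σ (predArgs Σ R) as))

  module _ {A B : Fin (nSorts Σ)} {f : Fin (nFun Σ)}
           (fArgs : funArgs Σ f ≡ A ∷ []) (fRes : funRes Σ f ≡ B) where

    apply₁ : Interpretation 𝒰 → Dom 𝒰 A → Dom 𝒰 B
    apply₁ I a = subst (Dom 𝒰) fRes (funI I f (subst (Tuple 𝒰) (sym fArgs) (a , tt)))

    apply₁-• : (σ : DomainPermutation 𝒰) (I : Interpretation 𝒰) (a : Dom 𝒰 A) →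
      apply₁ (σ • I) a ≡ applyPerm 𝒰 σ B (apply₁ I (Inverse.from (σ A) a))
    apply₁-• σ I a = transport fArgs fRes (funI I f)
      where
      transport : ∀ {θs θ} (θs≡A : θs ≡ A ∷ []) (θ≡B : θ ≡ B) (g : Tuple 𝒰 θs → Dom 𝒰 θ) →
        subst (Dom 𝒰) θ≡B
          (applyPerm 𝒰 σ θ (g (permTuple 𝒰 (inverse σ) θs (subst (Tuple 𝒰) (sym θs≡A) (a , tt)))))
        ≡ applyPerm 𝒰 σ B
            (subst (Dom 𝒰) θ≡B (g (subst (Tuple 𝒰) (sym θs≡A) (Inverse.from (σ A) a , tt))))
      transport refl refl g = refl

  permuteAt : (B : Fin (nSorts Σ)) → Dom 𝒰 B ↔ Dom 𝒰 B → DomainPermutation 𝒰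
  permuteAt B τ θ with θ ≟ B
  ... | yes refl = τ
  ... | no _     = ↔-refl

  applyPerm-permuteAt : (B : Fin (nSorts Σ)) (τ : Dom 𝒰 B ↔ Dom 𝒰 B) (b : Dom 𝒰 B) →
    applyPerm 𝒰 (permuteAt B τ) B b ≡ Inverse.to τ b
  applyPerm-permuteAt B τ b
    rewrite dec-yes-irr (B ≟ B) (Decidable⇒UIP.≡-irrelevant _≟_) refl = refl

  permuteAt-from-≢ : {A B : Fin (nSorts Σ)} → A ≢ B →
    (τ : Dom 𝒰 B ↔ Dom 𝒰 B) (a : Dom 𝒰 A) → Inverse.from (permuteAt B τ A) a ≡ a
  permuteAt-from-≢ {A} {B} A≢B τ a with A ≟ B
  ... | yes A≡B = ⊥-elim (A≢B A≡B)
  ... | no _    = refl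

mainTheorem5 : (Σ : Signature) (𝒰 : DomainAssignment Σ)
    (f : Fin (nFun Σ)) (A B : Fin (nSorts Σ))
    (fArgs : funArgs Σ f ≡ A ∷ []) (fRes : funRes Σ f ≡ B) → ¬ (A ≡ B) →
    (enumA : Fin (size 𝒰 A) ↔ Dom 𝒰 A) (enumB : Fin (size 𝒰 B) ↔ Dom 𝒰 B) →
    (I : Interpretation 𝒰) →
    Σ[ I' ∈ Interpretation 𝒰 ] (Isomorphic 𝒰 I I' ×
      ((i : Fin (size 𝒰 A)) → toℕ i < size 𝒰 B →
        Σ[ j ∈ Fin (size 𝒰 B) ] (toℕ j ≤ toℕ i ×
          subst (Dom 𝒰) fRes
            (funI I' f (subst (Tuple 𝒰) (sym fArgs) (Inverse.to enumA i , tt)))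
          ≡ Inverse.to enumB j)))
mainTheorem5 Σ 𝒰 f A B fArgs fRes A≢B enumA enumB I =
  σ • I , •-isomorphic σ I ,
  λ i i<n → π ⟨$⟩ʳ h i , ordered i i<n , placed (Inverse.to enumA i)
  where
  value : Interpretation 𝒰 → Dom 𝒰 A → Dom 𝒰 B
  value = apply₁ {𝒰 = 𝒰} fArgs fRes

  h : Fin (size 𝒰 A) → Fin (size 𝒰 B)
  h i = Inverse.from enumB (value I (Inverse.to enumA i))

  π : Permutation (size 𝒰 B) (size 𝒰 B)
  π = proj₁ (rangeOrdering h)

  ordered : ∀ i → RangeOrderedAt h π i
  ordered = proj₂ (rangeOrdering h)

  τ : Dom 𝒰 B ↔ Dom 𝒰 B
  τ = ↔-trans (↔-sym enumB) (↔-trans π enumB)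

  σ : DomainPermutation 𝒰
  σ = permuteAt {𝒰 = 𝒰} B τ

  placed : ∀ a → value (σ • I) a ≡ Inverse.to τ (value I a)
  placed a = begin
    value (σ • I) a
      ≡⟨ apply₁-• fArgs fRes σ I a ⟩
    applyPerm 𝒰 σ B (value I (Inverse.from (σ A) a))
      ≡⟨ cong (applyPerm 𝒰 σ B ∘′ value I) (permuteAt-from-≢ A≢B τ a) ⟩
    applyPerm 𝒰 σ B (value I a)
      ≡⟨ applyPerm-permuteAt B τ (value I a) ⟩
    Inverse.to τ (value I a)
      ∎
    where open ≡-Reasoning
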